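{- Let $\mathcal Q=\langle Q,\Sigma,\Gamma,\$,s,\delta\rangle$ be a queue machine and let $G_t$ ($t\in Q$) be the global types associated with $\mathcal Q$ as described in the context. Then for every $\gamma\in\Sigma^\star$: $\mathcal Q$ does not accept $\gamma$ if and only if the type configuration $G_s\parallel\gamma\$$ is balanced.
   Context: A queue machine is a tuple $\mathcal Q=\langle Q,\Sigma,\Gamma,\$,s,\delta\rangle$ with $Q$ a finite set of states, $\Gamma$ a finite queue alphabet, $\Sigma\subseteq\Gamma$ the input alphabet, $\$\in\Gamma\setminus\Sigma$ the initial queue symbol, $s\in Q$ the initial state, and $\delta:Q\times\Gamma\to Q\times\Gamma^\star$ a total transition function. Configurations are pairs $\langle t,\alpha\rangle\in Q\times\Gamma^\star$, with transitions $\langle t,a\alpha\rangle\to\langle t',\alpha\beta\rangle$ whenever $\delta(t,a)=\langle t',\beta\rangle$. A word $\gamma\in\Sigma^\star$ is accepted if $\langle s,\gamma\$\rangle\to^\star\langle t,\epsilon\rangle$ for some $t\in Q$ ($\epsilon$ the empty word). Global types are possibly infinite regular terms $G ::= \mathsf{End}\mid \mathsf p\mathsf q!\{\lambda_i;G_i\}_{i\in I}\mid\mathsf p\mathsf q?\{\lambda_i;G_i\}_{i\in I}$ ($I$ finite nonempty, $\mathsf p\neq\mathsf q$ participants, $\lambda_i$ pairwise distinct labels); singleton output is written $\mathsf p\mathsf q!\lambda;G$. Messages are triples $\langle\mathsf p,\lambda,\mathsf q\rangle$ and queues are finite sequences of messages ($\emptyset$ empty, $\cdot$ concatenation). Take two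 fixed participants $\mathsf p\neq\mathsf q$ and labels the symbols of $\Gamma$; a word $\alpha\in\Gamma^\star$ is identified with the queue of messages $\langle\mathsf p,a,\mathsf q\rangle$ for the successive letters $a$ of $\alpha$. For every state $t\in Q$, $G_t$ is defined by the (mutually corecursive) equations $G_t=\mathsf p\mathsf q?\{a;\ \mathsf p\mathsf q!b^a_1;\ldots;\mathsf p\mathsf q!b^a_{n_a};G_{t'_a}\}_{a\in\Gamma}$, where $\delta(t,a)=\langle t'_a,b^a_1\cdots b^a_{n_a}\rangle$. Readability $\mathrm{read}(G,\mathcal M)$ (inductive): $\mathrm{read}(G,\emptyset)$; $\mathrm{read}(\mathsf p\mathsf q!\{\lambda_i;G_i\}_{i\in I},\mathcal M)$ if $\mathrm{read}(G_i,\mathcal M)$ $\forall i$; $\mathrm{read}(\mathsf p\mathsf q?\{\lambda_i;G_i\}_{i\in I},\langle\mathsf p,\lambda_h,\mathsf q\rangle\cdot\mathcal M)$ if $h\in I$ and $\mathrm{read}(G_i,\mathcal M)$ $\forall i$; $\mathrm{read}(\mathsf p\mathsf q?\{\lambda_i;G_i\}_{i\in I},\mathcal M)$ if $\mathcal M$ does not start (up to the reordering of messages with different sender/receiver pairs) with any $\langle\mathsf p,\lambda_i,\mathsf q\rangle$, and $\mathrm{read}(G_i,\mathcal M)$ $\forall i$. Balancing (coinductive): $\mathsf{End}\parallel\emptyset$ is balanced; $G=\mathsf p\mathsf q!\{\lambda_i;G_i\}_{i\in I}$ with $\mathcal M$ is balanced if $\mathrm{read}(G,\mathcal M)$ and each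 $G_i\parallel\mathcal M\cdot\langle\mathsf p,\lambda_i,\mathsf q\rangle$ is balanced; $G=\mathsf p\mathsf q?\{\lambda_i;G_i\}_{i\in I}$ with $\langle\mathsf p,\lambda_h,\mathsf q\rangle\cdot\mathcal M$, $h\in I$, is balanced if $\mathrm{read}(G,\langle\mathsf p,\lambda_h,\mathsf q\rangle\cdot\mathcal M)$ and $G_h\parallel\mathcal M$ is balanced. -}

module Defs where

open import Data.Nat using (ℕ; zero; suc)
open import Data.Fin using (Fin)
open import Data.Fin.Subset using (Subset; _∈_; _∉_)
open import Data.List using (List; []; _∷_; _++_; [_]; map)
open import Data.List.Relation.Unary.All using (All)
open import Data.Product using (Σ; _×_; _,_; proj₁; proj₂; ∃)
open import Function.Definitions using (Injective)
open import Relation.Binary.PropositionalEquality using (_≡_; refl)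
open import Relation.Binary.Construct.Closure.ReflexiveTransitive using (Star)
open import Relation.Nullary using (¬_)

-- Queue machines  ⟨Q, Σ, Γ, $, s, δ⟩
-- Q = Fin nQ (finite), Γ = Fin (suc k) (finite, nonempty since $ ∈ Γ),
-- Σ ⊆ Γ a subset with $ ∉ Σ.

record QueueMachine : Set where
  field
    nQ     : ℕ
    k      : ℕ
    Sig    : Subset (suc k)
    dollar : Fin (suc k)
    dollar∉Sig : dollar ∉ Sig
    s      : Fin nQ
    δ      : Fin nQ → Fin (suc k) → Fin nQ × List (Fin (suc k))

module _ (𝒬 : QueueMachine) where
  open QueueMachine 𝒬

  Config : Set
  Config = Fin nQ × List (Fin (suc k))

  data Step : Config → Config → Set where
    step : ∀ t a α → Step (t , a ∷ α) (proj₁ (δ t a) , α ++ proj₂ (δ t a))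

  Accepts : List (Fin (suc k)) → Set
  Accepts γ = ∃ λ t → Star Step (s , γ ++ [ dollar ]) (t , [])

-- Coinduction (--guardedness) is not available, so a
-- possibly infinite term is presented as a node of a graph (coalgebra)
-- `unfold : Node → GTF Node`; the term denoted by a node is the (possibly
-- infinite) unfolding of the graph from that node.

module GlobalTypes (P L : Set) where

  Distinct : ∀ {n} → (Fin (suc n) → L) → Set
  Distinct {n} ls = (i j : Fin (suc n)) → ls i ≡ ls j → i ≡ j

  data GTF (X : Set) : Set where
    End : GTF X
    Out : (p q : P) (n : ℕ) (ls : Fin (suc n) → L) → Distinct ls →
          (Fin (suc n) → X) → GTF X
    Inp : (p q : P) (n : ℕ) (ls : Fin (suc n) → L) → Distinct ls →
          (Fin (suc n) → X) → GTF X

  record GTGraph : Set₁ where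
    field
      Node   : Set
      unfold : Node → GTF Node

  record Msg : Set where
    constructor ⟨_,_,_⟩
    field
      sender   : P
      label    : L
      receiver : P

  open Msg public

  Queue : Set
  Queue = List Msg

  data Swap : Queue → Queue → Set where
    swap : ∀ M M' m m' →
           ¬ (sender m ≡ sender m' × receiver m ≡ receiver m') →
           Swap (M ++ m ∷ m' ∷ M') (M ++ m' ∷ m ∷ M')

  -- queue equivalence (Swap is symmetric, so its reflexive-transitive
  -- closure is the generated equivalence)
  _≅_ : Queue → Queue → Set
  _≅_ = Star Swap

  StartsWith : Queue → Msg → Set
  StartsWith M m = ∃ λ M' → M ≅ (m ∷ M')

  module _ (𝒢 : GTGraph) where
    open GTGraph 𝒢

    data Read : GTF Node → Queue → Set where
      read-∅   : ∀ {G} → Read G []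
      read-out : ∀ {p q n ls d gs M} →
                 (∀ i → Read (unfold (gs i)) M) →
                 Read (Out p q n ls d gs) M
      read-inp : ∀ {p q n ls d gs M M₀} (h : Fin (suc n)) →
                 M₀ ≅ (⟨ p , ls h , q ⟩ ∷ M) →
                 (∀ i → Read (unfold (gs i)) M) →
                 Read (Inp p q n ls d gs) M₀
      read-skip : ∀ {p q n ls d gs M} →
                 (∀ i → ¬ StartsWith M ⟨ p , ls i , q ⟩) →
                 (∀ i → Read (unfold (gs i)) M) →
                 Read (Inp p q n ls d gs) M

    data BalStep (R : Node → Queue → Set) : GTF Node → Queue → Set where
      bal-end : BalStep R End []
      bal-out : ∀ {p q n ls d gs M} →
                Read (Out p q n ls d gs) M →
                (∀ i → R (gs i) (M ++ [ ⟨ p , ls i , q ⟩ ])) →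
                BalStep R (Out p q n ls d gs) M
      bal-inp : ∀ {p q n ls d gs M M₀} (h : Fin (suc n)) →
                M₀ ≅ (⟨ p , ls h , q ⟩ ∷ M) →
                Read (Inp p q n ls d gs) M₀ →
                R (gs h) M →
                BalStep R (Inp p q n ls d gs) M₀

    -- balancing G ∥ M (coinductive): greatest fixed point of BalStep,
    -- i.e. membership in some backward-closed (post-fixed) relation
    Balanced : Node → Queue → Set₁
    Balanced x M = Σ (Node → Queue → Set) λ R →
      R x M × (∀ y N → R y N → BalStep R (unfold y) N)

module Encoding (𝒬 : QueueMachine) (P : Set) (p q : P) where
  open QueueMachine 𝒬
  open GlobalTypes P (Fin (suc k)) public

  private
    id-dist : Distinct (λ (a : Fin (suc k)) → a)
    id-dist _ _ eq = eq

    const-dist : (b : Fin (suc k)) → Distinct {0} (λ _ → b)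
    const-dist b Fin.zero Fin.zero _ = refl

  -- node (t , b₁ … bₙ) denotes  pq!b₁; … ; pq!bₙ; G_t
  𝒢 : GTGraph
  GTGraph.Node 𝒢 = Fin nQ × List (Fin (suc k))
  GTGraph.unfold 𝒢 (t , []) =
    Inp p q k (λ a → a) id-dist (λ a → δ t a)
  GTGraph.unfold 𝒢 (t , b ∷ bs) =
    Out p q 0 (λ _ → b) (const-dist b) (λ _ → (t , bs))

  -- G_t = pq?{a ; pq!b^a_1; … ; pq!b^a_{n_a}; G_{t'_a}}_{a∈Γ}
  G : Fin nQ → GTGraph.Node 𝒢
  G t = (t , [])

  Bal : GTGraph.Node 𝒢 → Queue → Set₁
  Bal = Balanced 𝒢

  toQueue : List (Fin (suc k)) → Queue
  toQueue = map (λ a → ⟨ p , a , q ⟩)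

{-# OPTIONS --safe #-}
module Submission where

open import Defs
open import Data.Fin.Subset using (_∈_)
open import Data.List using (List; _++_; [_]; []; _∷_)
open import Data.List.Properties using (map-++; ++-assoc; ++-identityʳ)
open import Data.List.Relation.Unary.All using (All; []; _∷_)
open import Data.List.Relation.Unary.All.Properties using (++⁻ʳ)
open import Relation.Binary.PropositionalEquality
  using (_≢_; _≡_; refl; sym; trans; cong; subst)
open import Relation.Binary.Construct.Closure.ReflexiveTransitive using (Star; ε; _◅_)
open import Relation.Nullary using (¬_)
open import Function.Bundles using (_⇔_; mk⇔)
open import Data.Fin using (Fin)
open import Data.Nat using (suc)
open import Data.Product using (Σ; _×_; _,_; proj₁; proj₂; ∃)
open import Data.Empty using (⊥-elim)

-- A node (t , b₁ … bₙ) of the encoding together with the queue of a word α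
-- behaves exactly like the machine configuration ⟨t , α b₁ … bₙ⟩: pending
-- outputs append to the queue, and an input consumes the head and performs
-- δ.  All messages travel on the single channel p → q, so no reordering is
-- possible and every node can read every queue.  Hence the only way a
-- balancing derivation can get stuck is an input facing the empty queue,
-- i.e. a halted machine.  The non-halting configurations therefore form a
-- balancing relation, and conversely any balancing relation, followed along
-- a halting run, reaches an input on the empty queue, which is impossible.

module _ {P L : Set} where
  open GlobalTypes P L

  OnChannel : P → P → Msg → Set
  OnChannel p q m = sender m ≡ p × receiver m ≡ q

  ≅-single-channel⇒≡ : ∀ {p q M N} → All (OnChannel p q) M → M ≅ N → M ≡ N
  ≅-single-channel⇒≡ _ ε = refl
  ≅-single-channel⇒≡ onPQ (swap M _ m m' m≉m' ◅ _) with ++⁻ʳ M onPQ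
  ... | (sm , rm) ∷ (sm' , rm') ∷ _ = ⊥-elim (m≉m' (trans sm (sym sm') , trans rm (sym rm')))

module _ (𝒬 : QueueMachine) (P : Set) (p q : P) where
  open QueueMachine 𝒬
  open Encoding 𝒬 P p q
  open GTGraph 𝒢

  Halts : Config 𝒬 → Set
  Halts c = ∃ λ t → Star (Step 𝒬) c (t , [])

  config : Node → List (Fin (suc k)) → Config 𝒬
  config (t , bs) α = t , α ++ bs

  config-out : ∀ t b bs α → config (t , b ∷ bs) α ≡ config (t , bs) (α ++ [ b ])
  config-out t b bs α = cong (t ,_) (sym (++-assoc α [ b ] bs))

  config-inp : ∀ t a α → Step 𝒬 (config (t , []) (a ∷ α)) (config (δ t a) α)
  config-inp t a α =
    subst (λ w → Step 𝒬 (t , a ∷ w) (config (δ t a) α)) (sym (++-identityʳ α))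
      (step t a α)

  toQueue-onChannel : ∀ α → All (OnChannel p q) (toQueue α)
  toQueue-onChannel []      = []
  toQueue-onChannel (_ ∷ α) = (refl , refl) ∷ toQueue-onChannel α

  toQueue-snoc : ∀ α b → toQueue α ++ [ ⟨ p , b , q ⟩ ] ≡ toQueue (α ++ [ b ])
  toQueue-snoc α b = sym (map-++ _ α [ b ])

  read-toQueue : ∀ x α → Read 𝒢 (unfold x) (toQueue α)
  read-toQueue _            []      = read-∅
  read-toQueue (t , [])     (a ∷ α) = read-inp a ε (λ a' → read-toQueue (δ t a') α)
  read-toQueue (t , b ∷ bs) α       = read-out (λ _ → read-toQueue (t , bs) α)

  NonHalting : Node → Queue → Set
  NonHalting x M = Σ (List (Fin (suc k))) λ α → M ≡ toQueue α × ¬ Halts (config x α)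

  nonHalting-postFixed : ∀ x M → NonHalting x M → BalStep 𝒢 NonHalting (unfold x) M
  nonHalting-postFixed (t , b ∷ bs) _ (α , refl , ¬halts) =
    bal-out (read-toQueue (t , b ∷ bs) α) λ _ →
      α ++ [ b ] , toQueue-snoc α b ,
      λ halts → ¬halts (subst Halts (sym (config-out t b bs α)) halts)
  nonHalting-postFixed (t , []) _ ([] , refl , ¬halts) = ⊥-elim (¬halts (t , ε))
  nonHalting-postFixed (t , []) _ (a ∷ α , refl , ¬halts) =
    bal-inp a ε (read-toQueue (t , []) (a ∷ α))
      (α , refl , λ (t' , run) → ¬halts (t' , config-inp t a α ◅ run))

  module _ (R : Node → Queue → Set)
           (postFixed : ∀ x M → R x M → BalStep 𝒢 R (unfold x) M) where

    flush-outputs : ∀ t bs α → R (t , bs) (toQueue α) → R (t , []) (toQueue (α ++ bs))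
    flush-outputs t [] α r = subst (λ w → R (t , []) (toQueue w)) (sym (++-identityʳ α)) r
    flush-outputs t (b ∷ bs) α r with postFixed (t , b ∷ bs) (toQueue α) r
    ... | bal-out _ next =
      subst (λ w → R (t , []) (toQueue w)) (++-assoc α [ b ] bs)
        (flush-outputs t bs (α ++ [ b ]) (subst (R (t , bs)) (toQueue-snoc α b) (next Fin.zero)))

    postFixed-¬halts : ∀ {t α t'} → R (t , []) (toQueue α) → ¬ Star (Step 𝒬) (t , α) (t' , [])
    postFixed-¬halts {t} {[]} r ε with postFixed (t , []) [] r
    ... | bal-inp _ []≅ _ _ with ≅-single-channel⇒≡ {p = p} {q} [] []≅
    ... | ()
    postFixed-¬halts {t} {a ∷ α} r (step _ _ _ ◅ run)
      with postFixed (t , []) (toQueue (a ∷ α)) r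
    ... | bal-inp _ a∷α≅ _ r'
      with ≅-single-channel⇒≡ (toQueue-onChannel (a ∷ α)) a∷α≅
    ... | refl = postFixed-¬halts (flush-outputs (proj₁ (δ t a)) (proj₂ (δ t a)) α r') run

theorem5p3 : (𝒬 : QueueMachine) (P : Set) (p q : P) → p ≢ q →
    (γ : List (Fin (suc (QueueMachine.k 𝒬)))) →
    All (λ a → a ∈ QueueMachine.Sig 𝒬) γ →
    (¬ Accepts 𝒬 γ) ⇔
    Encoding.Bal 𝒬 P p q (Encoding.G 𝒬 P p q (QueueMachine.s 𝒬))
    (Encoding.toQueue 𝒬 P p q (γ ++ [ QueueMachine.dollar 𝒬 ]))
theorem5p3 𝒬 P p q _ γ _ = mk⇔ nonAccepting⇒balanced balanced⇒nonAccepting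
  where
    open QueueMachine 𝒬 using (s; dollar)
    open Encoding 𝒬 P p q using (Bal; G; toQueue)

    w : List (Fin (suc (QueueMachine.k 𝒬)))
    w = γ ++ [ dollar ]

    G-config : config 𝒬 P p q (G s) w ≡ (s , w)
    G-config = cong (s ,_) (++-identityʳ w)

    nonAccepting⇒balanced : ¬ Accepts 𝒬 γ → Bal (G s) (toQueue w)
    nonAccepting⇒balanced ¬acc =
      NonHalting 𝒬 P p q ,
      (w , refl , λ halts → ¬acc (subst (Halts 𝒬 P p q) G-config halts)) ,
      nonHalting-postFixed 𝒬 P p q

    balanced⇒nonAccepting : Bal (G s) (toQueue w) → ¬ Accepts 𝒬 γ
    balanced⇒nonAccepting (R , r , postFixed) (_ , run) =
      postFixed-¬halts 𝒬 P p q R postFixed r run
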